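{- Let $\mathcal{N}$ be the class of simple binary matroids that do not have $M(K_4)$ as an induced minor. If $N\in\mathcal{N}$, then the binary coning $A(N)$ is in $\mathcal{N}$.
   Context: All matroids are simple and binary; every contraction is immediately followed by simplification. An induced minor of $M$ is a matroid obtained from $M$ by a sequence of restrictions to flats and contractions (each contraction followed by simplification). For a simple binary matroid $N$ (viewed as a restriction of a binary projective geometry), its coning $A(N)$ is obtained by adding a coloop $p$ (the tip) to $N$ and then adding the third point on each projective line between $p$ and a point of $N$. -}

module Defs where

open import Data.Bool using (Bool; true; false; _xor_; if_then_else_; _∨_)
open import Data.Nat using (ℕ; suc)
open import Data.Fin using (Fin; _≟_)
open import Data.Vec using (Vec; []; _∷_; zipWith; replicate; lookup; tabulate)
open import Data.List using (List; []; _∷_; length)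
open import Data.List.Relation.Unary.All using (All)
open import Data.Product using (Σ; _×_; ∃; ∃-syntax)
open import Relation.Nullary using (¬_; does)
open import Relation.Unary using (Pred; _⊆_)
open import Relation.Binary.PropositionalEquality using (_≡_; _≢_)
open import Level using (0ℓ)

V : ℕ → Set
V n = Vec Bool n

𝟎 : ∀ {n} → V n
𝟎 {n} = replicate n false

infixl 6 _⊕_
_⊕_ : ∀ {n} → V n → V n → V n
_⊕_ = zipWith _xor_

-- A simple binary matroid with ambient space GF(2)^n is given by its ground
-- set, a set E of points of GF(2)^n (i.e. of PG(n-1,2)); it is simple iff
-- 0 ∉ E (parallel elements would be equal vectors, hence do not occur).
BinMat : ℕ → Set₁
BinMat n = Pred (V n) 0ℓ

Simple : ∀ {n} → BinMat n → Set
Simple E = ¬ E 𝟎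

linComb : ∀ {n} (xs : List (V n)) → Vec Bool (length xs) → V n
linComb []       []       = 𝟎
linComb (x ∷ xs) (c ∷ cs) = (if c then x else 𝟎) ⊕ linComb xs cs

Indep : ∀ {n} → List (V n) → Set
Indep xs = ∀ cs → linComb xs cs ≡ 𝟎 → cs ≡ replicate (length xs) false

InSpan : ∀ {n} → BinMat n → V n → Set
InSpan F v = Σ (List (V _)) λ xs → All F xs × Σ (Vec Bool (length xs)) λ cs → linComb xs cs ≡ v

IsFlat : ∀ {n} → BinMat n → BinMat n → Set
IsFlat E F = (F ⊆ E) × (∀ v → E v → InSpan F v → F v)

-- Contraction of the element e (with e_i = 1) followed by simplification:
-- the row operations making e the i-th unit vector send v to v + v_i e;
-- deleting row i (the i-th coordinate of v + v_i e is 0) represents M/e;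
-- removing the zero vector (loops) and identifying equal vectors (parallel
-- classes) is the simplification.
project : ∀ {n} → V n → Fin n → V n → V n
project e i w = w ⊕ (if lookup w i then e else 𝟎)

Contract : ∀ {n} → BinMat n → V n → Fin n → BinMat n
Contract E e i v = Σ (V _) λ w → E w × (v ≡ project e i w) × (v ≢ 𝟎)

data InducedMinor {n} (E : BinMat n) : BinMat n → Set₁ where
  done  : InducedMinor E E
  restr : ∀ {F G} → IsFlat E F → InducedMinor F G → InducedMinor E G
  contr : ∀ {G} (e : V n) (i : Fin n) → E e → lookup e i ≡ true →
          InducedMinor (Contract E e i) G → InducedMinor E G

-- Matroid isomorphism between binary matroids E ⊆ GF(2)^m and F ⊆ GF(2)^k:
-- a bijection of ground sets preserving independence of all finite subsets
-- (lists; duplicates are automatically dependent).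
record Iso {m k} (E : BinMat m) (F : BinMat k) : Set where
  field
    f        : V m → V k
    maps     : ∀ {v} → E v → F (f v)
    inj      : ∀ {v w} → E v → E w → f v ≡ f w → v ≡ w
    surj     : ∀ {u} → F u → Σ (V m) λ v → E v × f v ≡ u
    preserve : ∀ xs → All E xs → (Indep xs → Indep (Data.List.map f xs))
                                × (Indep (Data.List.map f xs) → Indep xs)

-- M(K4): the cycle matroid of K4, represented by the columns of the
-- vertex-edge incidence matrix of K4 over GF(2): the vectors e_i + e_j, i ≠ j.
edgeVec : Fin 4 → Fin 4 → V 4
edgeVec i j = tabulate λ k → does (k ≟ i) ∨ does (k ≟ j)

MK4 : BinMat 4
MK4 v = Σ (Fin 4) λ i → Σ (Fin 4) λ j → (i ≢ j) × (v ≡ edgeVec i j)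

HasMK4InducedMinor : ∀ {n} → BinMat n → Set₁
HasMK4InducedMinor E = Σ (BinMat _) λ G → InducedMinor E G × Iso G MK4

In𝒩 : ∀ {n} → BinMat n → Set₁
In𝒩 E = Simple E × ¬ HasMK4InducedMinor E

-- Binary coning: ambient GF(2)^(n+1) = GF(2) × GF(2)^n, N embedded as
-- (0, y), the tip p = (1, 0) is a coloop, and the third point on the line
-- through p and (0, y) is p + (0, y) = (1, y).
tipVec : ∀ {n} → V (suc n)
tipVec = true ∷ 𝟎

data Cone {n} (N : BinMat n) : BinMat (suc n) where
  tip   : Cone N tipVec
  base  : ∀ {y} → N y → Cone N (false ∷ y)
  third : ∀ {y} → N y → Cone N (tipVec ⊕ (false ∷ y))

{-# OPTIONS --safe #-}
-- Every induced minor of the coning A(N) is, up to isomorphism, an induced minor H of N or the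
-- coning A(H) of one. Restricting A(H) to a flat through the tip gives the coning of a flat of H,
-- restricting to a flat avoiding the tip gives a flat of H, contracting the tip gives H, and
-- contracting any other element e gives A(H / e). The isomorphisms are carried by a linear map π to
-- the ambient space of N that is injective on the span (with kernel {0, tip} in the coning case).
-- M(K4) is not a coning, even up to isomorphism (three distinct points are dependent iff they sum
-- to zero, so isomorphisms preserve tips): an edge and its opposite edge sum to (1,1,1,1), which is
-- not an edge. So an M(K4) induced minor of A(N) is already one of N.
module Submission where

open import Defs
open import Algebra.Bundles using (AbelianGroup)
open import Algebra.Structures using (IsAbelianGroup)
import Algebra.Properties.AbelianGroup as AbelianGroupProperties
import Algebra.Properties.CommutativeSemigroup as CommutativeSemigroupProperties
open import Data.Bool using (Bool; true; false; _xor_; if_then_else_)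
open import Data.Bool.Properties using (xor-assoc; xor-comm; xor-identityˡ; xor-identityʳ; xor-same)
  renaming (_≟_ to _≟B_)
open import Data.Empty using (⊥-elim)
open import Data.Fin using (Fin; zero; suc; _≟_; #_)
open import Data.Fin.Properties using (all?; any?)
open import Data.List using (List; []; _∷_; length; map)
open import Data.List.Membership.Propositional using (_∈_)
open import Data.List.Properties using (map-∘)
open import Data.List.Relation.Unary.All as All using (All; []; _∷_)
import Data.List.Relation.Unary.All.Properties as All
open import Data.List.Relation.Unary.Any as Any using (here; there)
open import Data.Nat using (ℕ)
open import Data.Product using (Σ; ∃; ∃₂; _×_; _,_; proj₁; proj₂)
open import Data.Sum using (_⊎_; inj₁; inj₂; [_,_]′)
open import Data.Vec using (Vec; []; _∷_; replicate; lookup; tail)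
open import Data.Vec.Properties using (≡-dec; zipWith-assoc; zipWith-comm; zipWith-identityˡ;
  zipWith-identityʳ; lookup-zipWith; ∷-injectiveˡ; ∷-injectiveʳ)
open import Function using (id; _∘_)
open import Level using (0ℓ)
open import Relation.Nullary using (¬_; Dec; yes; no; ¬?)
open import Relation.Nullary.Decidable using (toWitness; _×-dec_; _→-dec_; ¬¬-excluded-middle)
open import Relation.Unary using (_⊆_)
open import Relation.Binary.PropositionalEquality
  using (_≡_; _≢_; refl; sym; trans; cong; cong₂; subst; isEquivalence; module ≡-Reasoning)

infix 4 _≟V_
_≟V_ : ∀ {n} (u v : V n) → Dec (u ≡ v)
_≟V_ = ≡-dec _≟B_

⊕-self : ∀ {n} (v : V n) → v ⊕ v ≡ 𝟎
⊕-self []      = refl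
⊕-self (x ∷ v) = cong₂ _∷_ (xor-same x) (⊕-self v)

-- Over GF(2) every vector is its own negative.
⊕-isAbelianGroup : ∀ n → IsAbelianGroup _≡_ (_⊕_ {n}) 𝟎 id
⊕-isAbelianGroup n = record
  { isGroup = record
    { isMonoid = record
      { isSemigroup = record
        { isMagma = record { isEquivalence = isEquivalence ; ∙-cong = cong₂ _⊕_ }
        ; assoc = zipWith-assoc xor-assoc }
      ; identity = zipWith-identityˡ xor-identityˡ , zipWith-identityʳ xor-identityʳ }
    ; inverse = ⊕-self , ⊕-self
    ; ⁻¹-cong = cong id }
  ; comm = zipWith-comm xor-comm }

⊕-abelianGroup : ℕ → AbelianGroup 0ℓ 0ℓ
⊕-abelianGroup n = record { isAbelianGroup = ⊕-isAbelianGroup n }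

module _ {n : ℕ} where
  open AbelianGroup (⊕-abelianGroup n) public
    using () renaming (assoc to ⊕-assoc; comm to ⊕-comm; identityˡ to ⊕-identityˡ; identityʳ to ⊕-identityʳ)
  open AbelianGroupProperties (⊕-abelianGroup n) public
    using () renaming (inverseˡ-unique to x⊕y≡𝟎⇒x≡y; y≈x\\z to x⊕y≡z⇒y≡x⊕z; xyx⁻¹≈y to x⊕y⊕x≡y)
  open CommutativeSemigroupProperties (AbelianGroup.commutativeSemigroup (⊕-abelianGroup n)) public
    using () renaming (interchange to ⊕-interchange)

x⊕y⊕y≡x : ∀ {n} (u v : V n) → u ⊕ v ⊕ v ≡ u
x⊕y⊕y≡x {n} u v = AbelianGroupProperties.//-rightDividesʳ (⊕-abelianGroup n) v u

x≡y⇒x⊕y≡𝟎 : ∀ {n} {u v : V n} → u ≡ v → u ⊕ v ≡ 𝟎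
x≡y⇒x⊕y≡𝟎 {u = u} refl = ⊕-self u

∃-true-coordinate : ∀ {n} {v : V n} → v ≢ 𝟎 → ∃ λ j → lookup v j ≡ true
∃-true-coordinate {v = []}        v≢𝟎 = ⊥-elim (v≢𝟎 refl)
∃-true-coordinate {v = true ∷ v}  _   = zero , refl
∃-true-coordinate {v = false ∷ v} v≢𝟎 with ∃-true-coordinate (v≢𝟎 ∘ cong (false ∷_))
... | j , vj = suc j , vj

infixr 7 _·_
_·_ : ∀ {n} → Bool → V n → V n
c · v = if c then v else 𝟎

·-distribʳ-xor : ∀ {n} x y (v : V n) → (x xor y) · v ≡ x · v ⊕ y · v
·-distribʳ-xor true  true  v = sym (⊕-self v)
·-distribʳ-xor true  false v = sym (⊕-identityʳ v)
·-distribʳ-xor false y     v = sym (⊕-identityˡ (y · v))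

·-zeroʳ : ∀ {n} c → c · 𝟎 {n} ≡ 𝟎
·-zeroʳ true  = refl
·-zeroʳ false = refl

Linear : ∀ {m n} → (V m → V n) → Set
Linear φ = ∀ u v → φ (u ⊕ v) ≡ φ u ⊕ φ v

module _ {m n} {φ : V m → V n} (φ-linear : Linear φ) where

  linear-𝟎 : φ 𝟎 ≡ 𝟎
  linear-𝟎 = begin
    φ 𝟎           ≡⟨ cong φ (sym (⊕-self 𝟎)) ⟩
    φ (𝟎 ⊕ 𝟎)     ≡⟨ φ-linear 𝟎 𝟎 ⟩
    φ 𝟎 ⊕ φ 𝟎     ≡⟨ ⊕-self (φ 𝟎) ⟩
    𝟎             ∎
    where open ≡-Reasoning

  linear-· : ∀ c v → φ (c · v) ≡ c · φ v
  linear-· true  v = refl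
  linear-· false v = linear-𝟎

linear-∘ : ∀ {l m n} {ψ : V m → V n} {φ : V l → V m} → Linear ψ → Linear φ → Linear (ψ ∘ φ)
linear-∘ {ψ = ψ} ψ-linear φ-linear u v = trans (cong ψ (φ-linear u v)) (ψ-linear _ _)

project-linear : ∀ {n} (e : V n) i → Linear (project e i)
project-linear e i u v = begin
  (u ⊕ v) ⊕ lookup (u ⊕ v) i · e                 ≡⟨ cong (λ c → (u ⊕ v) ⊕ c · e) (lookup-zipWith _xor_ i u v) ⟩
  (u ⊕ v) ⊕ (lookup u i xor lookup v i) · e      ≡⟨ cong ((u ⊕ v) ⊕_) (·-distribʳ-xor (lookup u i) (lookup v i) e) ⟩
  (u ⊕ v) ⊕ (lookup u i · e ⊕ lookup v i · e)    ≡⟨ ⊕-interchange u v _ _ ⟩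
  project e i u ⊕ project e i v                  ∎
  where open ≡-Reasoning

project-self : ∀ {n} {e : V n} {i} → lookup e i ≡ true → project e i e ≡ 𝟎
project-self {e = e} ei = trans (cong (λ c → e ⊕ c · e) ei) (⊕-self e)

project-≡𝟎 : ∀ {n} {e : V n} {i} w → project e i w ≡ 𝟎 → w ≡ 𝟎 ⊎ w ≡ e
project-≡𝟎 {i = i} w eq with lookup w i
... | true  = inj₂ (x⊕y≡𝟎⇒x≡y _ _ eq)
... | false = inj₁ (trans (sym (⊕-identityʳ w)) eq)

project-kills : ∀ {n} {e : V n} {i w} → lookup e i ≡ true → w ≡ 𝟎 ⊎ w ≡ e → project e i w ≡ 𝟎
project-kills {e = e} {i} _  (inj₁ refl) = linear-𝟎 (project-linear e i)
project-kills             ei (inj₂ refl) = project-self ei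

project-absorbs : ∀ {n} {e : V n} {i} → lookup e i ≡ true → ∀ p → project e i (e ⊕ p) ≡ project e i p
project-absorbs {e = e} {i} ei p = begin
  project e i (e ⊕ p)                ≡⟨ project-linear e i e p ⟩
  project e i e ⊕ project e i p      ≡⟨ cong (_⊕ project e i p) (project-self ei) ⟩
  𝟎 ⊕ project e i p                  ≡⟨ ⊕-identityˡ (project e i p) ⟩
  project e i p                      ∎
  where open ≡-Reasoning

project-invariant : ∀ {m n} {χ : V m → V n} → Linear χ → ∀ {e} i → χ e ≡ 𝟎 → ∀ w → χ (project e i w) ≡ χ w
project-invariant {χ = χ} χ-linear {e} i χe≡𝟎 w = begin
  χ (w ⊕ lookup w i · e)        ≡⟨ χ-linear w _ ⟩
  χ w ⊕ χ (lookup w i · e)      ≡⟨ cong (χ w ⊕_) (linear-· χ-linear (lookup w i) e) ⟩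
  χ w ⊕ lookup w i · χ e        ≡⟨ cong (λ x → χ w ⊕ lookup w i · x) χe≡𝟎 ⟩
  χ w ⊕ lookup w i · 𝟎          ≡⟨ cong (χ w ⊕_) (·-zeroʳ (lookup w i)) ⟩
  χ w ⊕ 𝟎                       ≡⟨ ⊕-identityʳ (χ w) ⟩
  χ w                           ∎
  where open ≡-Reasoning

data Span {n} (F : BinMat n) : V n → Set where
  span-𝟎   : Span F 𝟎
  span-add : ∀ {x y} → F x → Span F y → Span F (x ⊕ y)

module _ {n} {F : BinMat n} where

  Span-⊕ : ∀ {u v} → Span F u → Span F v → Span F (u ⊕ v)
  Span-⊕ {v = v} span-𝟎 sv = subst (Span F) (sym (⊕-identityˡ v)) sv
  Span-⊕ {v = v} (span-add {x} {y} Fx sy) sv =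
    subst (Span F) (sym (⊕-assoc x y v)) (span-add Fx (Span-⊕ sy sv))

  ∈⇒Span : F ⊆ Span F
  ∈⇒Span {x} Fx = subst (Span F) (⊕-identityʳ x) (span-add Fx span-𝟎)

  linComb∈Span : ∀ {xs} → All F xs → ∀ cs → Span F (linComb xs cs)
  linComb∈Span []          []           = span-𝟎
  linComb∈Span (Fx ∷ Fxs)  (true ∷ cs)  = span-add Fx (linComb∈Span Fxs cs)
  linComb∈Span (Fx ∷ Fxs)  (false ∷ cs) = subst (Span F) (sym (⊕-identityˡ _)) (linComb∈Span Fxs cs)

  InSpan⇒Span : ∀ {v} → InSpan F v → Span F v
  InSpan⇒Span (xs , Fxs , cs , refl) = linComb∈Span Fxs cs

  Span⇒InSpan : ∀ {v} → Span F v → InSpan F v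
  Span⇒InSpan span-𝟎                   = [] , [] , [] , refl
  Span⇒InSpan (span-add {x} Fx sy) with Span⇒InSpan sy
  ... | xs , Fxs , cs , refl = x ∷ xs , Fx ∷ Fxs , true ∷ cs , refl

Span-mono : ∀ {n} {F G : BinMat n} → F ⊆ G → Span F ⊆ Span G
Span-mono F⊆G span-𝟎          = span-𝟎
Span-mono F⊆G (span-add Fx s) = span-add (F⊆G Fx) (Span-mono F⊆G s)

Image : ∀ {m n} → (V m → V n) → BinMat m → BinMat n
Image φ F y = ∃ λ u → F u × φ u ≡ y

infixl 5 _∖_
_∖_ : ∀ {n} → BinMat n → V n → BinMat n
(F ∖ p) u = F u × u ≢ p

SimpleImage : ∀ {m n} → (V m → V n) → BinMat m → BinMat n
SimpleImage φ F = Image φ F ∖ 𝟎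

module _ {m n} {φ : V m → V n} {F : BinMat m} where

  SimpleImage-simple : Simple (SimpleImage φ F)
  SimpleImage-simple (_ , 𝟎≢𝟎) = 𝟎≢𝟎 refl

  SimpleImage-∈ : ∀ (H : BinMat n) {u} → Simple H → F u → H (φ u) → SimpleImage φ F (φ u)
  SimpleImage-∈ H {u} H-simple Fu Hφu = (u , Fu , refl) , λ φu≡𝟎 → H-simple (subst H φu≡𝟎 Hφu)

Span-image : ∀ {m n} {φ : V m → V n} → Linear φ → ∀ {F y} → Span (Image φ F) y → ∃ λ v → Span F v × φ v ≡ y
Span-image φ-linear span-𝟎 = 𝟎 , span-𝟎 , linear-𝟎 φ-linear
Span-image φ-linear (span-add (u , Fu , refl) s) with Span-image φ-linear s
... | v , sv , refl = u ⊕ v , span-add Fu sv , φ-linear u v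

Span-Contract : ∀ {n} {E : BinMat n} {e i v} → Span (Contract E e i) v → ∃ λ x → Span E x × project e i x ≡ v
Span-Contract {e = e} {i} s =
  Span-image (project-linear e i) (Span-mono (λ { (w , Ew , refl , _) → w , Ew , refl }) s)

Contract-simple : ∀ {n} {E : BinMat n} {e i} → Simple (Contract E e i)
Contract-simple (_ , _ , _ , 𝟎≢𝟎) = 𝟎≢𝟎 refl

-- length (map φ xs) is only propositionally equal to length xs, so coefficient vectors are
-- transported by recursion on xs.
module _ {m n} (φ : V m → V n) where

  pullCoeffs : ∀ xs → Vec Bool (length (map φ xs)) → Vec Bool (length xs)
  pullCoeffs []       []       = []
  pullCoeffs (x ∷ xs) (c ∷ cs) = c ∷ pullCoeffs xs cs

  pushCoeffs : ∀ xs → Vec Bool (length xs) → Vec Bool (length (map φ xs))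
  pushCoeffs []       []       = []
  pushCoeffs (x ∷ xs) (c ∷ cs) = c ∷ pushCoeffs xs cs

  pullCoeffs-trivial : ∀ xs cs → pullCoeffs xs cs ≡ replicate _ false → cs ≡ replicate _ false
  pullCoeffs-trivial []       []       _  = refl
  pullCoeffs-trivial (x ∷ xs) (c ∷ cs) eq =
    cong₂ _∷_ (∷-injectiveˡ eq) (pullCoeffs-trivial xs cs (∷-injectiveʳ eq))

  pushCoeffs-trivial : ∀ xs cs → pushCoeffs xs cs ≡ replicate _ false → cs ≡ replicate _ false
  pushCoeffs-trivial []       []       _  = refl
  pushCoeffs-trivial (x ∷ xs) (c ∷ cs) eq =
    cong₂ _∷_ (∷-injectiveˡ eq) (pushCoeffs-trivial xs cs (∷-injectiveʳ eq))

  module _ (φ-linear : Linear φ) where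

    linComb-map-pull : ∀ xs cs → linComb (map φ xs) cs ≡ φ (linComb xs (pullCoeffs xs cs))
    linComb-map-pull []       []       = sym (linear-𝟎 φ-linear)
    linComb-map-pull (x ∷ xs) (c ∷ cs) =
      trans (cong₂ _⊕_ (sym (linear-· φ-linear c x)) (linComb-map-pull xs cs)) (sym (φ-linear _ _))

    linComb-map-push : ∀ xs cs → linComb (map φ xs) (pushCoeffs xs cs) ≡ φ (linComb xs cs)
    linComb-map-push []       []       = sym (linear-𝟎 φ-linear)
    linComb-map-push (x ∷ xs) (c ∷ cs) =
      trans (cong₂ _⊕_ (sym (linear-· φ-linear c x)) (linComb-map-push xs cs)) (sym (φ-linear _ _))

    Indep-map⁺ : ∀ {E xs} → (∀ {v} → Span E v → φ v ≡ 𝟎 → v ≡ 𝟎) → All E xs → Indep xs → Indep (map φ xs)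
    Indep-map⁺ {xs = xs} φ-kernel Exs xs-indep cs eq = pullCoeffs-trivial xs cs
      (xs-indep (pullCoeffs xs cs) (φ-kernel (linComb∈Span Exs _) (trans (sym (linComb-map-pull xs cs)) eq)))

    Indep-map⁻ : ∀ {xs} → Indep (map φ xs) → Indep xs
    Indep-map⁻ {xs} φxs-indep cs eq = pushCoeffs-trivial xs cs
      (φxs-indep (pushCoeffs xs cs) (trans (linComb-map-push xs cs) (trans (cong φ eq) (linear-𝟎 φ-linear))))

linComb-triple : ∀ {n} (a b c : V n) x y z →
                 linComb (a ∷ b ∷ c ∷ []) (x ∷ y ∷ z ∷ []) ≡ (x · a ⊕ y · b) ⊕ z · c
linComb-triple a b c x y z = begin
  x · a ⊕ (y · b ⊕ (z · c ⊕ 𝟎))   ≡⟨ cong (λ t → x · a ⊕ (y · b ⊕ t)) (⊕-identityʳ (z · c)) ⟩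
  x · a ⊕ (y · b ⊕ z · c)         ≡⟨ sym (⊕-assoc (x · a) (y · b) (z · c)) ⟩
  (x · a ⊕ y · b) ⊕ z · c         ∎
  where open ≡-Reasoning

indep-triple : ∀ {n} {a b c : V n} → a ≢ 𝟎 → b ≢ 𝟎 → c ≢ 𝟎 → a ≢ b → a ≢ c → b ≢ c → a ⊕ b ≢ c →
               Indep (a ∷ b ∷ c ∷ [])
indep-triple {a = a} {b} {c} a≢𝟎 b≢𝟎 c≢𝟎 a≢b a≢c b≢c a⊕b≢c (x ∷ y ∷ z ∷ []) eq =
  trivial x y z (x⊕y≡𝟎⇒x≡y _ _ (trans (sym (linComb-triple a b c x y z)) eq))
  where
  trivial : ∀ x y z → x · a ⊕ y · b ≡ z · c → x ∷ y ∷ z ∷ [] ≡ replicate 3 false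
  trivial false false false _ = refl
  trivial true  false false e = ⊥-elim (a≢𝟎 (trans (sym (⊕-identityʳ a)) e))
  trivial false true  false e = ⊥-elim (b≢𝟎 (trans (sym (⊕-identityˡ b)) e))
  trivial true  true  false e = ⊥-elim (a≢b (x⊕y≡𝟎⇒x≡y a b e))
  trivial false false true  e = ⊥-elim (c≢𝟎 (trans (sym e) (⊕-identityˡ 𝟎)))
  trivial true  false true  e = ⊥-elim (a≢c (trans (sym (⊕-identityʳ a)) e))
  trivial false true  true  e = ⊥-elim (b≢c (trans (sym (⊕-identityˡ b)) e))
  trivial true  true  true  e = ⊥-elim (a⊕b≢c e)

line-dependent : ∀ {n} (u w : V n) → ¬ Indep (u ∷ w ∷ (u ⊕ w) ∷ [])
line-dependent u w indep with indep (true ∷ true ∷ true ∷ [])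
  (trans (linComb-triple u w (u ⊕ w) true true true) (⊕-self (u ⊕ w)))
... | ()

Iso-trans : ∀ {l m k} {A : BinMat l} {B : BinMat m} {C : BinMat k} → Iso A B → Iso B C → Iso A C
Iso-trans {l} {m} {k} {A} {B} {C} AB BC = record
  { f        = g ∘ f
  ; maps     = λ Aa → BC.maps (AB.maps Aa)
  ; inj      = λ Aa Aa′ eq → AB.inj Aa Aa′ (BC.inj (AB.maps Aa) (AB.maps Aa′) eq)
  ; surj     = surj
  ; preserve = preserve
  }
  where
  module AB = Iso AB
  module BC = Iso BC
  f : V l → V m
  f = AB.f
  g : V m → V k
  g = BC.f
  surj : ∀ {c} → C c → ∃ λ a → A a × g (f a) ≡ c
  surj Cc with BC.surj Cc
  ... | b , Bb , refl with AB.surj Bb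
  ... | a , Aa , refl = a , Aa , refl
  preserve : ∀ xs → All A xs → (Indep xs → Indep (map (g ∘ f) xs)) × (Indep (map (g ∘ f) xs) → Indep xs)
  preserve xs Axs rewrite map-∘ {g = g} {f} xs =
    (λ i → proj₁ (BC.preserve _ Bfxs) (proj₁ (AB.preserve xs Axs) i)) ,
    (λ i → proj₂ (AB.preserve xs Axs) (proj₂ (BC.preserve _ Bfxs) i))
    where
    Bfxs : All B (map f xs)
    Bfxs = All.map⁺ (All.map AB.maps Axs)

Listing : ∀ {n} → BinMat n → Set
Listing {n} E = Σ (List (V n)) λ xs → All E xs × (∀ {u} → E u → u ∈ xs)

Iso-listing : ∀ {m k} {E : BinMat m} {K : BinMat k} → Iso E K → Listing K → Listing E
Iso-listing {m} {E = E} {K} iso (xs , Kxs , K⊆xs) =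
  preimages Kxs , preimages-∈ Kxs , λ Eu → preimage-∈ Kxs Eu (K⊆xs (maps Eu))
  where
  open Iso iso
  preimage : ∀ {x} → K x → V m
  preimage Kx = proj₁ (surj Kx)
  E-preimage : ∀ {x} (Kx : K x) → E (preimage Kx)
  E-preimage Kx = proj₁ (proj₂ (surj Kx))
  f-preimage : ∀ {x} (Kx : K x) → f (preimage Kx) ≡ x
  f-preimage Kx = proj₂ (proj₂ (surj Kx))
  preimages : ∀ {xs} → All K xs → List (V m)
  preimages []         = []
  preimages (Kx ∷ Kxs) = preimage Kx ∷ preimages Kxs
  preimages-∈ : ∀ {xs} (Kxs : All K xs) → All E (preimages Kxs)
  preimages-∈ []         = []
  preimages-∈ (Kx ∷ Kxs) = E-preimage Kx ∷ preimages-∈ Kxs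
  preimage-∈ : ∀ {xs} (Kxs : All K xs) {u} → E u → f u ∈ xs → u ∈ preimages Kxs
  preimage-∈ (Kx ∷ _)  Eu (here fu≡x)   = here (inj Eu (E-preimage Kx) (trans fu≡x (sym (f-preimage Kx))))
  preimage-∈ (_ ∷ Kxs) Eu (there fu∈xs) = there (preimage-∈ Kxs Eu fu∈xs)

-- Off φ(E) the section takes the junk value 𝟎.
module _ {m n} {E : BinMat m} (E-listing : Listing E) (φ : V m → V n) where

  private
    xs : List (V m)
    xs = proj₁ E-listing

  section : V n → V m
  section y with Any.any? (λ x → φ x ≟V y) xs
  ... | yes p = Any.lookup p
  ... | no _  = 𝟎

  section-spec : ∀ {u} → E u → E (section (φ u)) × φ (section (φ u)) ≡ φ u
  section-spec {u} Eu with Any.any? (λ x → φ x ≟V φ u) xs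
  ... | yes p = All.lookupAny (proj₁ (proj₂ E-listing)) p
  ... | no ¬p = ⊥-elim (¬p (Any.map (λ u≡x → cong φ (sym u≡x)) (proj₂ (proj₂ E-listing) Eu)))

Apex : ∀ {n} → BinMat n → V n → Set
Apex E p = E p × (∀ {u} → E u → u ≢ p → E (u ⊕ p))

module _ {m k} {E : BinMat m} {K : BinMat k} (iso : Iso E K) (E-simple : Simple E) (K-simple : Simple K) where

  open Iso iso

  -- f maps the dependent triple u, w, u ⊕ w to a dependent triple of distinct nonzero vectors,
  -- and such a triple sums to zero.
  Iso-line : ∀ {u w} → E u → E w → E (u ⊕ w) → u ≢ w → f (u ⊕ w) ≡ f u ⊕ f w
  Iso-line {u} {w} Eu Ew Euw u≢w with f (u ⊕ w) ≟V f u ⊕ f w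
  ... | yes eq = eq
  ... | no neq = ⊥-elim (line-dependent u w (proj₂ (preserve _ (Eu ∷ Ew ∷ Euw ∷ []))
          (indep-triple (image≢𝟎 Eu) (image≢𝟎 Ew) (image≢𝟎 Euw)
            (u≢w ∘ inj Eu Ew)
            (λ eq → w≢𝟎 (trans (x⊕y≡z⇒y≡x⊕z u w u (sym (inj Eu Euw eq))) (⊕-self u)))
            (λ eq → u≢𝟎 (trans (x⊕y≡z⇒y≡x⊕z w u w (trans (⊕-comm w u) (sym (inj Ew Euw eq)))) (⊕-self w)))
            (neq ∘ sym))))
    where
    image≢𝟎 : ∀ {v} → E v → f v ≢ 𝟎
    image≢𝟎 Ev eq = K-simple (subst K eq (maps Ev))
    u≢𝟎 : u ≢ 𝟎
    u≢𝟎 eq = E-simple (subst E eq Eu)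
    w≢𝟎 : w ≢ 𝟎
    w≢𝟎 eq = E-simple (subst E eq Ew)

  Iso-apex : ∀ {p} → Apex E p → Apex K (f p)
  Iso-apex {p} (Ep , E-closed) = maps Ep , K-closed
    where
    K-closed : ∀ {x} → K x → x ≢ f p → K (x ⊕ f p)
    K-closed Kx x≢fp with surj Kx
    ... | u , Eu , refl = subst K (Iso-line Eu Ep (E-closed Eu u≢p) u≢p) (maps (E-closed Eu u≢p))
      where
      u≢p : u ≢ p
      u≢p = x≢fp ∘ cong f

MK4-simple : Simple MK4
MK4-simple (zero ,                   _ , _ , ())
MK4-simple (suc zero ,               _ , _ , ())
MK4-simple (suc (suc zero) ,         _ , _ , ())
MK4-simple (suc (suc (suc zero)) ,   _ , _ , ())

K4-edges : List (V 4)
K4-edges = edgeVec (# 0) (# 1) ∷ edgeVec (# 0) (# 2) ∷ edgeVec (# 0) (# 3)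
         ∷ edgeVec (# 1) (# 2) ∷ edgeVec (# 1) (# 3) ∷ edgeVec (# 2) (# 3) ∷ []

MK4-listing : Listing MK4
MK4-listing = K4-edges , edges∈MK4 , λ { (i , j , i≢j , refl) → edges-complete i j i≢j }
  where
  edges∈MK4 : All MK4 K4-edges
  edges∈MK4 = (# 0 , # 1 , (λ ()) , refl) ∷ (# 0 , # 2 , (λ ()) , refl) ∷ (# 0 , # 3 , (λ ()) , refl)
            ∷ (# 1 , # 2 , (λ ()) , refl) ∷ (# 1 , # 3 , (λ ()) , refl) ∷ (# 2 , # 3 , (λ ()) , refl) ∷ []
  edges-complete : ∀ i j → i ≢ j → edgeVec i j ∈ K4-edges
  edges-complete = toWitness {a? = all? λ i → all? λ j → ¬? (i ≟ j) →-dec Any.any? (edgeVec i j ≟V_) K4-edges} _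

ones : V 4
ones = true ∷ true ∷ true ∷ true ∷ []

K4-perfect-matching : ∀ i j → i ≢ j → ∃₂ λ k l → k ≢ l × edgeVec k l ⊕ edgeVec i j ≡ ones
K4-perfect-matching = toWitness {a? = all? λ i → all? λ j → ¬? (i ≟ j) →-dec
  any? λ k → any? λ l → ¬? (k ≟ l) ×-dec (edgeVec k l ⊕ edgeVec i j ≟V ones)} _

ones∉MK4 : ¬ MK4 ones
ones∉MK4 (i , j , _ , eq) = edgeVec≢ones i j (sym eq)
  where
  edgeVec≢ones : ∀ i j → edgeVec i j ≢ ones
  edgeVec≢ones = toWitness {a? = all? λ i → all? λ j → ¬? (edgeVec i j ≟V ones)} _

MK4-apex-free : ∀ {p} → ¬ Apex MK4 p
MK4-apex-free ((i , j , i≢j , refl) , MK4-closed) with K4-perfect-matching i j i≢j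
... | k , l , k≢l , sum≡ones = ones∉MK4 (subst MK4 sum≡ones (MK4-closed (k , l , k≢l , refl) kl≢ij))
  where
  kl≢ij : edgeVec k l ≢ edgeVec i j
  kl≢ij eq with trans (sym sum≡ones) (x≡y⇒x⊕y≡𝟎 eq)
  ... | ()

InducedMinor-trans : ∀ {n} {E F G : BinMat n} → InducedMinor E F → InducedMinor F G → InducedMinor E G
InducedMinor-trans done                 FG = FG
InducedMinor-trans (restr flat EF)      FG = restr flat (InducedMinor-trans EF FG)
InducedMinor-trans (contr e i Ee ei EF) FG = contr e i Ee ei (InducedMinor-trans EF FG)

SimpleImage-isFlat : ∀ {m n} {φ : V m → V n} {E F : BinMat m} {H : BinMat n} →
  Linear φ → IsFlat E F → Simple H → SimpleImage φ F ⊆ H →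
  (∀ {v} → Span F v → H (φ v) → ∃ λ u → E u × Span F u × φ u ≡ φ v) →
  IsFlat H (SimpleImage φ F)
SimpleImage-isFlat {φ = φ} {F = F} {H} φ-linear (_ , F-closed) H-simple image⊆H lift = image⊆H , closed
  where
  closed : ∀ y → H y → InSpan (SimpleImage φ F) y → SimpleImage φ F y
  closed y Hy y∈span with Span-image φ-linear (Span-mono proj₁ (InSpan⇒Span y∈span))
  ... | v , v∈span , refl with lift v∈span Hy
  ... | u , Eu , u∈span , φu≡φv =
    (u , F-closed u Eu (Span⇒InSpan u∈span) , φu≡φv) , λ φv≡𝟎 → H-simple (subst H φv≡𝟎 Hy)

module Contraction {m n} {π : V m → V n} (π-linear : Linear π) (e : V m) (i : Fin m) (πe≢𝟎 : π e ≢ 𝟎) where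

  j : Fin n
  j = proj₁ (∃-true-coordinate πe≢𝟎)

  πe-j : lookup (π e) j ≡ true
  πe-j = proj₂ (∃-true-coordinate πe≢𝟎)

  πᶜ : V m → V n
  πᶜ = project (π e) j ∘ π

  πᶜ-linear : Linear πᶜ
  πᶜ-linear = linear-∘ (project-linear (π e) j) π-linear

  πᶜ-project : ∀ w → πᶜ (project e i w) ≡ πᶜ w
  πᶜ-project = project-invariant πᶜ-linear i (project-self πe-j)

  πᶜ-𝟎 : ∀ {w} → π w ≡ 𝟎 → πᶜ w ≡ 𝟎
  πᶜ-𝟎 πw≡𝟎 = trans (cong (project (π e) j) πw≡𝟎) (linear-𝟎 (project-linear (π e) j))

  πᶜ≡𝟎 : ∀ w → πᶜ w ≡ 𝟎 → π w ≡ 𝟎 ⊎ π w ≡ π e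
  πᶜ≡𝟎 w = project-≡𝟎 (π w)

  πᶜ-maps : ∀ {H : BinMat n} {w} → H (π w) → πᶜ (project e i w) ≢ 𝟎 → Contract H (π e) j (πᶜ (project e i w))
  πᶜ-maps {w = w} Hπw u≢𝟎 = π w , Hπw , πᶜ-project w , u≢𝟎

  πᶜ-onto : ∀ {E : BinMat m} {H : BinMat n} → (∀ {z} → H z → ∃ λ w → E w × π w ≡ z) →
            ∀ {y} → Contract H (π e) j y → ∃ λ u → Contract E e i u × πᶜ u ≡ y
  πᶜ-onto onto (z , Hz , refl , y≢𝟎) with onto Hz
  ... | w , Ew , refl = project e i w , (w , Ew , refl , u≢𝟎) , πᶜ-project w
    where
    u≢𝟎 : project e i w ≢ 𝟎
    u≢𝟎 u≡𝟎 = y≢𝟎 (trans (sym (πᶜ-project w)) (trans (cong πᶜ u≡𝟎) (linear-𝟎 πᶜ-linear)))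

module _ {n} (N : BinMat n) where

  -- E ≅ H for a simple induced minor H of N, the isomorphism being π.
  record MinorCopy {m} (E : BinMat m) : Set₁ where
    field
      minor        : BinMat n
      minor-of-N   : InducedMinor N minor
      minor-simple : Simple minor
      π            : V m → V n
      π-linear     : Linear π
      π-maps       : ∀ {u} → E u → minor (π u)
      π-onto       : ∀ {y} → minor y → ∃ λ u → E u × π u ≡ y
      π-kernel     : ∀ {v} → Span E v → π v ≡ 𝟎 → v ≡ 𝟎

    π-injective : ∀ {u v} → Span E u → Span E v → π u ≡ π v → u ≡ v
    π-injective {u} {v} su sv πu≡πv =
      x⊕y≡𝟎⇒x≡y u v (π-kernel (Span-⊕ su sv) (trans (π-linear u v) (x≡y⇒x⊕y≡𝟎 πu≡πv)))

  -- E ≅ A(H) for a simple induced minor H of N; apex is the tip and π projects away from it.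
  record MinorCone {m} (E : BinMat m) : Set₁ where
    field
      minor        : BinMat n
      minor-of-N   : InducedMinor N minor
      minor-simple : Simple minor
      π            : V m → V n
      π-linear     : Linear π
      apex         : V m
      isApex       : Apex E apex
      apex≢𝟎       : apex ≢ 𝟎
      π-apex       : π apex ≡ 𝟎
      π-maps       : ∀ {u} → E u → u ≢ apex → minor (π u)
      π-onto       : ∀ {y} → minor y → ∃ λ u → E u × π u ≡ y
      π-kernel     : ∀ {v} → Span E v → π v ≡ 𝟎 → v ≡ 𝟎 ⊎ v ≡ apex

    π-fibre : ∀ {u v} → Span E u → Span E v → π u ≡ π v → u ≡ v ⊎ u ≡ v ⊕ apex
    π-fibre {u} {v} su sv πu≡πv with π-kernel (Span-⊕ su sv) (trans (π-linear u v) (x≡y⇒x⊕y≡𝟎 πu≡πv))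
    ... | inj₁ u⊕v≡𝟎   = inj₁ (x⊕y≡𝟎⇒x≡y u v u⊕v≡𝟎)
    ... | inj₂ u⊕v≡apex = inj₂ (x⊕y≡z⇒y≡x⊕z v u apex (trans (⊕-comm v u) u⊕v≡apex))

    ≢apex : ∀ {u} → minor (π u) → u ≢ apex
    ≢apex {u} mπu u≡apex = minor-simple (subst minor (trans (cong π u≡apex) π-apex) mπu)

    E-simple : Simple E
    E-simple E𝟎 = minor-simple (subst minor (linear-𝟎 π-linear) (π-maps E𝟎 (apex≢𝟎 ∘ sym)))

  Good : ∀ {m} → BinMat m → Set₁
  Good E = MinorCopy E ⊎ MinorCone E

  restrict-copy : ∀ {m} {E F : BinMat m} → MinorCopy E → IsFlat E F → MinorCopy F
  restrict-copy {E = E} {F} c F-flat@(F⊆E , _) = record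
    { minor        = SimpleImage π F
    ; minor-of-N   = InducedMinor-trans minor-of-N (restr image-flat done)
    ; minor-simple = SimpleImage-simple
    ; π            = π
    ; π-linear     = π-linear
    ; π-maps       = λ Fu → SimpleImage-∈ minor minor-simple Fu (π-maps (F⊆E Fu))
    ; π-onto       = proj₁
    ; π-kernel     = λ s → π-kernel (Span-mono F⊆E s)
    }
    where
    open MinorCopy c
    image-flat : IsFlat minor (SimpleImage π F)
    image-flat = SimpleImage-isFlat π-linear F-flat minor-simple
      (λ { ((u , Fu , refl) , _) → π-maps (F⊆E Fu) }) lift
      where
      lift : ∀ {v} → Span F v → minor (π v) → ∃ λ u → E u × Span F u × π u ≡ π v
      lift v∈span mπv with π-onto mπv
      ... | u , Eu , πu≡πv =
        u , Eu , subst (Span F) (sym (π-injective (∈⇒Span Eu) (Span-mono F⊆E v∈span) πu≡πv)) v∈span , πu≡πv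

  restrict-cone : ∀ {m} {E F : BinMat m} (c : MinorCone E) → IsFlat E F → F (MinorCone.apex c) → MinorCone F
  restrict-cone {E = E} {F} c F-flat@(F⊆E , F-closed) F-apex = record
    { minor        = SimpleImage π F
    ; minor-of-N   = InducedMinor-trans minor-of-N (restr image-flat done)
    ; minor-simple = SimpleImage-simple
    ; π            = π
    ; π-linear     = π-linear
    ; apex         = apex
    ; isApex       = F-apex , F-through-apex
    ; apex≢𝟎       = apex≢𝟎
    ; π-apex       = π-apex
    ; π-maps       = λ Fu u≢apex → SimpleImage-∈ minor minor-simple Fu (π-maps (F⊆E Fu) u≢apex)
    ; π-onto       = proj₁
    ; π-kernel     = λ s → π-kernel (Span-mono F⊆E s)
    }
    where
    open MinorCone c
    F-through-apex : ∀ {u} → F u → u ≢ apex → F (u ⊕ apex)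
    F-through-apex Fu u≢apex =
      F-closed _ (proj₂ isApex (F⊆E Fu) u≢apex) (Span⇒InSpan (Span-⊕ (∈⇒Span Fu) (∈⇒Span F-apex)))
    image-flat : IsFlat minor (SimpleImage π F)
    image-flat = SimpleImage-isFlat π-linear F-flat minor-simple
      (λ { ((u , Fu , refl) , πu≢𝟎) → π-maps (F⊆E Fu) (λ { refl → πu≢𝟎 π-apex }) }) lift
      where
      lift : ∀ {v} → Span F v → minor (π v) → ∃ λ u → E u × Span F u × π u ≡ π v
      lift {v} v∈span mπv with π-onto mπv
      ... | u , Eu , πu≡πv = u , Eu , u∈span (π-fibre (∈⇒Span Eu) (Span-mono F⊆E v∈span) πu≡πv) , πu≡πv
        where
        u∈span : u ≡ v ⊎ u ≡ v ⊕ apex → Span F u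
        u∈span (inj₁ refl) = v∈span
        u∈span (inj₂ refl) = Span-⊕ v∈span (∈⇒Span F-apex)

  restrict-cone-off-apex : ∀ {m} {E F : BinMat m} (c : MinorCone E) → IsFlat E F → ¬ F (MinorCone.apex c) →
                           MinorCopy F
  restrict-cone-off-apex {E = E} {F} c F-flat@(F⊆E , F-closed) F∌apex = record
    { minor        = SimpleImage π F
    ; minor-of-N   = InducedMinor-trans minor-of-N (restr image-flat done)
    ; minor-simple = SimpleImage-simple
    ; π            = π
    ; π-linear     = π-linear
    ; π-maps       = λ Fu → SimpleImage-∈ minor minor-simple Fu (π-maps (F⊆E Fu) (F-≢apex Fu))
    ; π-onto       = proj₁
    ; π-kernel     = kernel
    }
    where
    open MinorCone c
    F-≢apex : ∀ {u} → F u → u ≢ apex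
    F-≢apex Fu refl = F∌apex Fu
    kernel : ∀ {v} → Span F v → π v ≡ 𝟎 → v ≡ 𝟎
    kernel v∈span πv≡𝟎 with π-kernel (Span-mono F⊆E v∈span) πv≡𝟎
    ... | inj₁ v≡𝟎  = v≡𝟎
    ... | inj₂ refl = ⊥-elim (F∌apex (F-closed _ (proj₁ isApex) (Span⇒InSpan v∈span)))
    image-flat : IsFlat minor (SimpleImage π F)
    image-flat = SimpleImage-isFlat π-linear F-flat minor-simple
      (λ { ((u , Fu , refl) , _) → π-maps (F⊆E Fu) (F-≢apex Fu) }) lift
      where
      lift : ∀ {v} → Span F v → minor (π v) → ∃ λ u → E u × Span F u × π u ≡ π v
      lift {v} v∈span mπv with π-onto mπv
      ... | u , Eu , πu≡πv = v , Ev (π-fibre (∈⇒Span Eu) (Span-mono F⊆E v∈span) πu≡πv) , v∈span , refl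
        where
        u≢apex : u ≢ apex
        u≢apex = ≢apex (subst minor (sym πu≡πv) mπv)
        Ev : u ≡ v ⊎ u ≡ v ⊕ apex → E v
        Ev (inj₁ refl) = Eu
        Ev (inj₂ refl) = subst E (x⊕y⊕y≡x v apex) (proj₂ isApex Eu u≢apex)

  contract-copy : ∀ {m} {E : BinMat m} {e i} → MinorCopy E → E e → lookup e i ≡ true →
                  MinorCopy (Contract E e i)
  contract-copy {E = E} {e} {i} c Ee ei = record
    { minor        = Contract minor (π e) j
    ; minor-of-N   = InducedMinor-trans minor-of-N (contr (π e) j (π-maps Ee) πe-j done)
    ; minor-simple = Contract-simple
    ; π            = πᶜ
    ; π-linear     = πᶜ-linear
    ; π-maps       = maps
    ; π-onto       = πᶜ-onto π-onto
    ; π-kernel     = kernel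
    }
    where
    open MinorCopy c
    πe≢𝟎 : π e ≢ 𝟎
    πe≢𝟎 πe≡𝟎 = minor-simple (subst minor πe≡𝟎 (π-maps Ee))
    open Contraction π-linear e i πe≢𝟎
    project-kernel : ∀ {w} → Span E w → πᶜ w ≡ 𝟎 → project e i w ≡ 𝟎
    project-kernel w∈span πᶜw≡𝟎 = project-kills ei
      ([ (λ πw≡𝟎 → inj₁ (π-kernel w∈span πw≡𝟎))
       , (λ πw≡πe → inj₂ (π-injective w∈span (∈⇒Span Ee) πw≡πe))
       ]′ (πᶜ≡𝟎 _ πᶜw≡𝟎))
    maps : ∀ {u} → Contract E e i u → Contract minor (π e) j (πᶜ u)
    maps (w , Ew , refl , u≢𝟎) =
      πᶜ-maps (π-maps Ew) (λ eq → u≢𝟎 (project-kernel (∈⇒Span Ew) (trans (sym (πᶜ-project w)) eq)))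
    kernel : ∀ {v} → Span (Contract E e i) v → πᶜ v ≡ 𝟎 → v ≡ 𝟎
    kernel s πᶜv≡𝟎 with Span-Contract s
    ... | x , x∈span , refl = project-kernel x∈span (trans (sym (πᶜ-project x)) πᶜv≡𝟎)

  contract-cone-apex : ∀ {m} {E : BinMat m} (c : MinorCone E) i → lookup (MinorCone.apex c) i ≡ true →
                       MinorCopy (Contract E (MinorCone.apex c) i)
  contract-cone-apex {E = E} c i apex-i = record
    { minor        = minor
    ; minor-of-N   = minor-of-N
    ; minor-simple = minor-simple
    ; π            = π
    ; π-linear     = π-linear
    ; π-maps       = maps
    ; π-onto       = onto
    ; π-kernel     = kernel
    }
    where
    open MinorCone c
    π-project : ∀ w → π (project apex i w) ≡ π w
    π-project = project-invariant π-linear i π-apex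
    maps : ∀ {u} → Contract E apex i u → minor (π u)
    maps (w , Ew , refl , u≢𝟎) =
      subst minor (sym (π-project w)) (π-maps Ew (λ { refl → u≢𝟎 (project-self apex-i) }))
    onto : ∀ {y} → minor y → ∃ λ u → Contract E apex i u × π u ≡ y
    onto my with π-onto my
    ... | w , Ew , refl = project apex i w , (w , Ew , refl , u≢𝟎) , π-project w
      where
      u≢𝟎 : project apex i w ≢ 𝟎
      u≢𝟎 u≡𝟎 = minor-simple
        (subst minor (trans (sym (π-project w)) (trans (cong π u≡𝟎) (linear-𝟎 π-linear))) my)
    kernel : ∀ {v} → Span (Contract E apex i) v → π v ≡ 𝟎 → v ≡ 𝟎
    kernel s πv≡𝟎 with Span-Contract s
    ... | x , x∈span , refl = project-kills apex-i (π-kernel x∈span (trans (sym (π-project x)) πv≡𝟎))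

  contract-cone : ∀ {m} {E : BinMat m} {e i} (c : MinorCone E) → E e → e ≢ MinorCone.apex c →
                  lookup e i ≡ true → MinorCone (Contract E e i)
  contract-cone {m} {E} {e} {i} c Ee e≢apex ei = record
    { minor        = Contract minor (π e) j
    ; minor-of-N   = InducedMinor-trans minor-of-N (contr (π e) j (π-maps Ee e≢apex) πe-j done)
    ; minor-simple = Contract-simple
    ; π            = πᶜ
    ; π-linear     = πᶜ-linear
    ; apex         = apex′
    ; isApex       = (apex , proj₁ isApex , refl , apex′≢𝟎) , closed
    ; apex≢𝟎       = apex′≢𝟎
    ; π-apex       = trans (πᶜ-project apex) (πᶜ-𝟎 π-apex)
    ; π-maps       = maps
    ; π-onto       = πᶜ-onto π-onto
    ; π-kernel     = kernel
    }
    where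
    open MinorCone c
    πe≢𝟎 : π e ≢ 𝟎
    πe≢𝟎 πe≡𝟎 = minor-simple (subst minor πe≡𝟎 (π-maps Ee e≢apex))
    open Contraction π-linear e i πe≢𝟎
    apex′ : V m
    apex′ = project e i apex
    apex′≢𝟎 : apex′ ≢ 𝟎
    apex′≢𝟎 eq = [ apex≢𝟎 , e≢apex ∘ sym ]′ (project-≡𝟎 apex eq)
    project-kernel : ∀ {w} → Span E w → πᶜ w ≡ 𝟎 → project e i w ≡ 𝟎 ⊎ project e i w ≡ apex′
    project-kernel w∈span πᶜw≡𝟎 =
      [ (λ πw≡𝟎 → on-kernel (π-kernel w∈span πw≡𝟎))
      , (λ πw≡πe → on-fibre (π-fibre w∈span (∈⇒Span Ee) πw≡πe))
      ]′ (πᶜ≡𝟎 _ πᶜw≡𝟎)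
      where
      on-kernel : ∀ {w} → w ≡ 𝟎 ⊎ w ≡ apex → project e i w ≡ 𝟎 ⊎ project e i w ≡ apex′
      on-kernel (inj₁ refl) = inj₁ (linear-𝟎 (project-linear e i))
      on-kernel (inj₂ refl) = inj₂ refl
      on-fibre : ∀ {w} → w ≡ e ⊎ w ≡ e ⊕ apex → project e i w ≡ 𝟎 ⊎ project e i w ≡ apex′
      on-fibre (inj₁ refl) = inj₁ (project-self ei)
      on-fibre (inj₂ refl) = inj₂ (project-absorbs ei apex)
    maps : ∀ {u} → Contract E e i u → u ≢ apex′ → Contract minor (π e) j (πᶜ u)
    maps (w , Ew , refl , u≢𝟎) u≢apex′ = πᶜ-maps (π-maps Ew (u≢apex′ ∘ cong (project e i)))
      (λ eq → [ u≢𝟎 , u≢apex′ ]′ (project-kernel (∈⇒Span Ew) (trans (sym (πᶜ-project w)) eq)))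
    closed : ∀ {u} → Contract E e i u → u ≢ apex′ → Contract E e i (u ⊕ apex′)
    closed (w , Ew , refl , _) u≢apex′ =
      w ⊕ apex , proj₂ isApex Ew (u≢apex′ ∘ cong (project e i)) , sym (project-linear e i w apex) ,
      u≢apex′ ∘ x⊕y≡𝟎⇒x≡y _ _
    kernel : ∀ {v} → Span (Contract E e i) v → πᶜ v ≡ 𝟎 → v ≡ 𝟎 ⊎ v ≡ apex′
    kernel s πᶜv≡𝟎 with Span-Contract s
    ... | x , x∈span , refl = project-kernel x∈span (trans (sym (πᶜ-project x)) πᶜv≡𝟎)

  copy-iso : ∀ {m} {E : BinMat m} (c : MinorCopy E) → Listing E → Iso (MinorCopy.minor c) E
  copy-iso {m} {E} c E-listing = record
    { f        = g
    ; maps     = proj₁ ∘ spec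
    ; inj      = λ my my′ eq → trans (sym (proj₂ (spec my))) (trans (cong π eq) (proj₂ (spec my′)))
    ; surj     = surj
    ; preserve = preserve
    }
    where
    open MinorCopy c
    g : V n → V m
    g = section E-listing π
    spec : ∀ {y} → minor y → E (g y) × π (g y) ≡ y
    spec my with π-onto my
    ... | u , Eu , refl = section-spec E-listing π Eu
    surj : ∀ {u} → E u → ∃ λ y → minor y × g y ≡ u
    surj {u} Eu = π u , π-maps Eu , π-injective (∈⇒Span E-gπu) (∈⇒Span Eu) πgπu≡πu
      where
      E-gπu : E (g (π u))
      E-gπu = proj₁ (spec (π-maps Eu))
      πgπu≡πu : π (g (π u)) ≡ π u
      πgπu≡πu = proj₂ (spec (π-maps Eu))
    π∘g : ∀ {ys} → All minor ys → map π (map g ys) ≡ ys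
    π∘g []         = refl
    π∘g (my ∷ mys) = cong₂ _∷_ (proj₂ (spec my)) (π∘g mys)
    preserve : ∀ ys → All minor ys → (Indep ys → Indep (map g ys)) × (Indep (map g ys) → Indep ys)
    preserve ys mys =
      (λ ys-indep → Indep-map⁻ π π-linear {map g ys} (subst Indep (sym (π∘g mys)) ys-indep)) ,
      (λ gys-indep → subst Indep (π∘g mys) (Indep-map⁺ π π-linear π-kernel E-gys gys-indep))
      where
      E-gys : All E (map g ys)
      E-gys = All.map⁺ (All.map (proj₁ ∘ spec) mys)

  cone-minorCone : Simple N → MinorCone (Cone N)
  cone-minorCone N-simple = record
    { minor        = N
    ; minor-of-N   = done
    ; minor-simple = N-simple
    ; π            = tail
    ; π-linear     = λ { (_ ∷ _) (_ ∷ _) → refl }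
    ; apex         = tipVec
    ; isApex       = tip , closed
    ; apex≢𝟎       = λ ()
    ; π-apex       = refl
    ; π-maps       = maps
    ; π-onto       = λ {y} Ny → false ∷ y , base Ny , refl
    ; π-kernel     = kernel
    }
    where
    closed : ∀ {u} → Cone N u → u ≢ tipVec → Cone N (u ⊕ tipVec)
    closed tip            tip≢tip = ⊥-elim (tip≢tip refl)
    closed (base {y} Ny)  _       = subst (Cone N) (⊕-comm tipVec (false ∷ y)) (third Ny)
    closed (third {y} Ny) _       = subst (Cone N) (sym (x⊕y⊕x≡y tipVec (false ∷ y))) (base Ny)
    maps : ∀ {u} → Cone N u → u ≢ tipVec → N (tail u)
    maps tip            tip≢tip = ⊥-elim (tip≢tip refl)
    maps (base Ny)      _       = Ny
    maps (third {y} Ny) _       = subst N (sym (⊕-identityˡ y)) Ny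
    kernel : ∀ {v} → Span (Cone N) v → tail v ≡ 𝟎 → v ≡ 𝟎 ⊎ v ≡ tipVec
    kernel {true ∷ _}  _ tail≡𝟎 = inj₂ (cong (true ∷_) tail≡𝟎)
    kernel {false ∷ _} _ tail≡𝟎 = inj₁ (cong (false ∷_) tail≡𝟎)

  -- Whether a flat contains the apex cannot be decided, but the conclusion is negative.
  InducedMinor-¬¬Good : ∀ {m} {E G : BinMat m} → InducedMinor E G → Good E → ¬ ¬ Good G
  InducedMinor-¬¬Good done good ¬good = ¬good good
  InducedMinor-¬¬Good (restr flat EG) (inj₁ c) = InducedMinor-¬¬Good EG (inj₁ (restrict-copy c flat))
  InducedMinor-¬¬Good (restr flat EG) (inj₂ c) ¬good = ¬¬-excluded-middle λ where
    (yes F-apex) → InducedMinor-¬¬Good EG (inj₂ (restrict-cone c flat F-apex)) ¬good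
    (no F∌apex)  → InducedMinor-¬¬Good EG (inj₁ (restrict-cone-off-apex c flat F∌apex)) ¬good
  InducedMinor-¬¬Good (contr e i Ee ei EG) (inj₁ c) = InducedMinor-¬¬Good EG (inj₁ (contract-copy c Ee ei))
  InducedMinor-¬¬Good (contr e i Ee ei EG) (inj₂ c) with e ≟V MinorCone.apex c
  ... | yes refl  = InducedMinor-¬¬Good EG (inj₁ (contract-cone-apex c i ei))
  ... | no e≢apex = InducedMinor-¬¬Good EG (inj₂ (contract-cone c Ee e≢apex ei))

  Good⇒¬Iso-MK4 : ¬ HasMK4InducedMinor N → ∀ {m} {G : BinMat m} → Good G → ¬ Iso G MK4
  Good⇒¬Iso-MK4 N-MK4-free (inj₁ c) iso =
    N-MK4-free (minor , minor-of-N , Iso-trans (copy-iso c (Iso-listing iso MK4-listing)) iso)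
    where open MinorCopy c
  Good⇒¬Iso-MK4 _          (inj₂ c) iso = MK4-apex-free (Iso-apex iso E-simple MK4-simple isApex)
    where open MinorCone c

lemma4p4 : (n : ℕ) (N : BinMat n) → In𝒩 N → In𝒩 (Cone N)
lemma4p4 n N (N-simple , N-MK4-free) = MinorCone.E-simple cone , λ { (G , G-minor , iso) →
  InducedMinor-¬¬Good N G-minor (inj₂ cone) λ good → Good⇒¬Iso-MK4 N N-MK4-free good iso }
  where
  cone : MinorCone N (Cone N)
  cone = cone-minorCone N N-simple
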